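{- Let $m\ge1$, let $p\ge5$ be a prime and let $A\in\Gamma_1(m,p)$ be an element of finite order $k\in\{1,2,3,4,6\}$. Then $1$ is an eigenvalue of $A$.
   Context: $\Gamma_1(m,p)$ is the subgroup of $GL_m(\mathbb{Z})$ of matrices whose last row is congruent to $(0,\dots,0,1)$ mod $p$. -}

module Defs where

open import Data.Nat using (ℕ; zero; suc)
open import Data.Fin using (Fin; zero; suc; fromℕ)
open import Data.Integer as ℤ using (ℤ; +_; _-_)
open import Data.Integer.Divisibility using (_∣_)
open import Data.Rational as ℚ using (ℚ; _/_)
open import Relation.Binary.PropositionalEquality using (_≡_)
open import Relation.Nullary using (Dec; yes; no)
open import Data.Fin using (_≟_)

Mat : Set → ℕ → Set
Mat R m = Fin m → Fin m → R

sumℤ : ∀ {n} → (Fin n → ℤ) → ℤ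
sumℤ {zero}  f = + 0
sumℤ {suc n} f = f zero ℤ.+ sumℤ (λ i → f (suc i))

sumℚ : ∀ {n} → (Fin n → ℚ) → ℚ
sumℚ {zero}  f = ℚ.0ℚ
sumℚ {suc n} f = f zero ℚ.+ sumℚ (λ i → f (suc i))

_⊗_ : ∀ {m} → Mat ℤ m → Mat ℤ m → Mat ℤ m
(A ⊗ B) i j = sumℤ (λ l → A i l ℤ.* B l j)

δ : ∀ {m} → Fin m → Fin m → ℤ
δ i j with i ≟ j
... | yes _ = + 1
... | no  _ = + 0

I : ∀ {m} → Mat ℤ m
I = δ

_^_ : ∀ {m} → Mat ℤ m → ℕ → Mat ℤ m
A ^ zero  = I
A ^ suc k = A ⊗ (A ^ k)

InGL : ∀ {m} → Mat ℤ m → Set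
InGL {m} A = Σ' (Mat ℤ m) λ B → (∀ i j → (A ⊗ B) i j ≡ I i j) × (∀ i j → (B ⊗ A) i j ≡ I i j)
  where
  open import Data.Product using (_×_) renaming (Σ to Σ')

_≡_[mod_] : ℤ → ℤ → ℕ → Set
a ≡ b [mod p ] = (+ p) ∣ (a - b)

-- Γ₁(m,p) for m = suc n: A ∈ GL_m(ℤ) and the last row of A is ≡ (0,…,0,1) mod p
InΓ₁ : (n p : ℕ) → Mat ℤ (suc n) → Set
InΓ₁ n p A = InGL A × (∀ j → A (fromℕ n) j ≡ δ (fromℕ n) j [mod p ])
  where open import Data.Product using (_×_)

HasOrder : ∀ {m} → Mat ℤ m → ℕ → Set
HasOrder {m} A k =
  (∀ i j → (A ^ k) i j ≡ I i j) ×
  (∀ j → 0 < j → j < k → ¬ (∀ a b → (A ^ j) a b ≡ I a b)) ×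
  0 < k
  where
  open import Data.Product using (_×_)
  open import Data.Nat using (_<_)
  open import Relation.Nullary using (¬_)

IsEigenvalue : ∀ {m} → Mat ℤ m → ℚ → Set
IsEigenvalue {m} A λ' =
  Σ (Fin m → ℚ) λ v → (Σ (Fin m) λ i → ¬ (v i ≡ ℚ.0ℚ)) ×
    (∀ i → sumℚ (λ j → (A i j / 1) ℚ.* v j) ≡ λ' ℚ.* v i)
  where
  open import Data.Product using (Σ; _×_)
  open import Relation.Nullary using (¬_)

-- If Aᵏ = I, the column v = (I + A + ⋯ + Aᵏ⁻¹) eₘ is fixed by A. Modulo p the last row of every
-- power of A is eₘ, so the last coordinate of v is ≡ k (mod p); it is nonzero since a prime
-- p ≥ 5 does not divide k, a divisor of 12.
module Submission where

open import Defs
open import Data.Nat using (ℕ; suc; _≤_)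
open import Data.Nat.Primality using (Prime)
open import Data.Integer using (ℤ)
open import Data.Rational using (1ℚ)
open import Data.Sum using (_⊎_)
open import Relation.Binary.PropositionalEquality using (_≡_)

open import Data.Empty using (⊥-elim)
open import Data.Fin as Fin using (Fin; fromℕ)
open import Data.Integer as ℤ using (+_; _+_; _-_; _*_)
import Data.Integer.Divisibility.Signed as ℤ
import Data.Integer.Properties as ℤ
open import Algebra.Properties.AbelianGroup ℤ.+-0-abelianGroup using (∙-cancelʳ)
open import Data.Integer.Tactic.RingSolver using (solve-∀)
open import Data.Nat as ℕ using (zero)
open import Data.Nat.Divisibility as ℕ using (_∣_)
import Data.Nat.Properties as ℕ
open import Data.Nat.Primality using (euclidsLemma)
open import Data.Product using (_,_)
open import Data.Rational as ℚ using (ℚ; _/_)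
import Data.Rational.Properties as ℚ
open import Data.Rational.Literals using (fromℤ)
open import Data.Sum using (inj₁; inj₂)
open import Function using (_∘_)
open import Relation.Binary.PropositionalEquality
  using (refl; sym; trans; cong; cong₂; subst; module ≡-Reasoning)
open import Relation.Nullary using (¬_; yes; no)

open ≡-Reasoning

private
  variable
    m : ℕ

sumℤ-cong : {f g : Fin m → ℤ} → (∀ i → f i ≡ g i) → sumℤ f ≡ sumℤ g
sumℤ-cong {zero}  f≗g = refl
sumℤ-cong {suc m} f≗g = cong₂ _+_ (f≗g Fin.zero) (sumℤ-cong (λ i → f≗g (Fin.suc i)))

sumℤ-zero : sumℤ {m} (λ _ → + 0) ≡ + 0
sumℤ-zero {zero}  = refl
sumℤ-zero {suc m} = trans (ℤ.+-identityˡ _) (sumℤ-zero {m})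

sumℤ-+ : (f g : Fin m → ℤ) → sumℤ (λ i → f i + g i) ≡ sumℤ f + sumℤ g
sumℤ-+ {zero}  f g = refl
sumℤ-+ {suc m} f g = begin
  (f₀ + g₀) + sumℤ (λ i → f (Fin.suc i) + g (Fin.suc i))
    ≡⟨ cong (λ s → (f₀ + g₀) + s) (sumℤ-+ (λ i → f (Fin.suc i)) (λ i → g (Fin.suc i))) ⟩
  (f₀ + g₀) + (sumℤ (λ i → f (Fin.suc i)) + sumℤ (λ i → g (Fin.suc i)))
    ≡⟨ interchange f₀ g₀ _ _ ⟩
  (f₀ + sumℤ (λ i → f (Fin.suc i))) + (g₀ + sumℤ (λ i → g (Fin.suc i))) ∎
  where
  f₀ = f Fin.zero
  g₀ = g Fin.zero
  interchange : ∀ a b c d → (a + b) + (c + d) ≡ (a + c) + (b + d)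
  interchange = solve-∀

sumℤ-∣ : ∀ {d} (f : Fin m → ℤ) → (∀ i → d ℤ.∣ f i) → d ℤ.∣ sumℤ f
sumℤ-∣ {zero}  f d∣f = ℤ.∣ᵤ⇒∣ (_ ℕ.∣0)
sumℤ-∣ {suc m} f d∣f = ℤ.∣m∣n⇒∣m+n (d∣f Fin.zero) (sumℤ-∣ _ (λ i → d∣f (Fin.suc i)))

δ-diag : (i : Fin m) → δ i i ≡ + 1
δ-diag i with i Fin.≟ i
... | yes _   = refl
... | no i≢i = ⊥-elim (i≢i refl)

δ-suc : (i j : Fin m) → δ (Fin.suc i) (Fin.suc j) ≡ δ i j
δ-suc i j with i Fin.≟ j
... | yes _ = refl
... | no _  = refl

sumℤ-δ : (i : Fin m) (f : Fin m → ℤ) → sumℤ (λ l → δ i l * f l) ≡ f i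
sumℤ-δ {suc m} Fin.zero f = begin
  + 1 * f Fin.zero + sumℤ {m} (λ _ → + 0)
    ≡⟨ cong₂ _+_ (ℤ.*-identityˡ (f Fin.zero)) (sumℤ-zero {m}) ⟩
  f Fin.zero + + 0
    ≡⟨ ℤ.+-identityʳ (f Fin.zero) ⟩
  f Fin.zero ∎
sumℤ-δ {suc m} (Fin.suc i) f = begin
  + 0 + sumℤ (λ l → δ (Fin.suc i) (Fin.suc l) * f (Fin.suc l))
    ≡⟨ ℤ.+-identityˡ _ ⟩
  sumℤ (λ l → δ (Fin.suc i) (Fin.suc l) * f (Fin.suc l))
    ≡⟨ sumℤ-cong (λ l → cong (_* f (Fin.suc l)) (δ-suc i l)) ⟩
  sumℤ (λ l → δ i l * f (Fin.suc l))
    ≡⟨ sumℤ-δ i (λ l → f (Fin.suc l)) ⟩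
  f (Fin.suc i) ∎

⊗-zeroʳ : (A : Mat ℤ m) → ∀ i j → (A ⊗ (λ _ _ → + 0)) i j ≡ + 0
⊗-zeroʳ {m} A i j = trans (sumℤ-cong (λ l → ℤ.*-zeroʳ (A i l))) (sumℤ-zero {m})

⊗-distribˡ-+ : (A B C : Mat ℤ m) → ∀ i j →
               (A ⊗ (λ k l → B k l + C k l)) i j ≡ (A ⊗ B) i j + (A ⊗ C) i j
⊗-distribˡ-+ A B C i j = trans (sumℤ-cong (λ l → ℤ.*-distribˡ-+ (A i l) (B l j) (C l j)))
                                 (sumℤ-+ (λ l → A i l * B l j) (λ l → A i l * C l j))

geometricSum : Mat ℤ m → ℕ → Mat ℤ m
geometricSum A zero    i j = + 0
geometricSum A (suc k) i j = (A ^ k) i j + geometricSum A k i j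

⊗-geometricSum : (A : Mat ℤ m) (k : ℕ) → ∀ i j →
                 (A ⊗ geometricSum A k) i j + I i j ≡ geometricSum A k i j + (A ^ k) i j
⊗-geometricSum A zero    i j = cong (_+ I i j) (⊗-zeroʳ A i j)
⊗-geometricSum A (suc k) i j = begin
  (A ⊗ geometricSum A (suc k)) i j + I i j
    ≡⟨ cong (_+ I i j) (⊗-distribˡ-+ A (A ^ k) (geometricSum A k) i j) ⟩
  ((A ^ suc k) i j + (A ⊗ geometricSum A k) i j) + I i j
    ≡⟨ ℤ.+-assoc ((A ^ suc k) i j) _ _ ⟩
  (A ^ suc k) i j + ((A ⊗ geometricSum A k) i j + I i j)
    ≡⟨ cong (λ s → (A ^ suc k) i j + s) (⊗-geometricSum A k i j) ⟩
  (A ^ suc k) i j + (geometricSum A k i j + (A ^ k) i j)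
    ≡⟨ rotate ((A ^ k) i j) (geometricSum A k i j) ((A ^ suc k) i j) ⟩
  ((A ^ k) i j + geometricSum A k i j) + (A ^ suc k) i j ∎
  where
  rotate : ∀ a g b → b + (g + a) ≡ (a + g) + b
  rotate = solve-∀

^≡I⇒⊗-geometricSum : (A : Mat ℤ m) (k : ℕ) → (∀ i j → (A ^ k) i j ≡ I i j) →
                     ∀ i j → (A ⊗ geometricSum A k) i j ≡ geometricSum A k i j
^≡I⇒⊗-geometricSum A k Aᵏ≡I i j =
  ∙-cancelʳ (I i j) _ _
    (trans (⊗-geometricSum A k i j) (cong (λ s → geometricSum A k i j + s) (Aᵏ≡I i j)))

-- The integers are explicit arguments: Defs states congruence through the absolute value ∣ a - b ∣,
-- from which Agda cannot infer a and b.
module _ {p : ℕ} where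

  ≡[mod]-by : ∀ a b {x} → a - b ≡ x → + p ℤ.∣ x → a ≡ b [mod p ]
  ≡[mod]-by a b refl p∣x = ℤ.∣⇒∣ᵤ p∣x

  ≡[mod]-refl : ∀ a → a ≡ a [mod p ]
  ≡[mod]-refl a = ≡[mod]-by a a (ℤ.+-inverseʳ a) (ℤ.∣ᵤ⇒∣ (p ℕ.∣0))

  ≡[mod]-trans : ∀ a b c → a ≡ b [mod p ] → b ≡ c [mod p ] → a ≡ c [mod p ]
  ≡[mod]-trans a b c a≡b b≡c =
    ≡[mod]-by a c (split a b c) (ℤ.∣m∣n⇒∣m+n {m = a - b} (ℤ.∣ᵤ⇒∣ a≡b) (ℤ.∣ᵤ⇒∣ b≡c))
    where
    split : ∀ a b c → a - c ≡ (a - b) + (b - c)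
    split = solve-∀

  ≡[mod]-+ : ∀ a b c d → a ≡ b [mod p ] → c ≡ d [mod p ] → (a + c) ≡ (b + d) [mod p ]
  ≡[mod]-+ a b c d a≡b c≡d =
    ≡[mod]-by (a + c) (b + d) (split a b c d) (ℤ.∣m∣n⇒∣m+n {m = a - b} (ℤ.∣ᵤ⇒∣ a≡b) (ℤ.∣ᵤ⇒∣ c≡d))
    where
    split : ∀ a b c d → (a + c) - (b + d) ≡ (a - b) + (c - d)
    split = solve-∀

  ∣⇒+≡[mod] : ∀ x y → + p ℤ.∣ x → (x + y) ≡ y [mod p ]
  ∣⇒+≡[mod] x y = ≡[mod]-by (x + y) y (cancel x y)
    where
    cancel : ∀ x y → (x + y) - y ≡ x
    cancel = solve-∀

  0≡[mod]⇒∣ : ∀ k → (+ 0) ≡ (+ k) [mod p ] → p ∣ k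
  0≡[mod]⇒∣ k = subst (p ∣_) (trans (cong ℤ.∣_∣ (ℤ.+-identityˡ (ℤ.- + k))) (ℤ.∣-i∣≡∣i∣ (+ k)))

module _ {p : ℕ} (A : Mat ℤ m) (r : Fin m) (rowA : ∀ j → A r j ≡ δ r j [mod p ]) where

  row-⊗ : (B : Mat ℤ m) → ∀ l → (A ⊗ B) r l ≡ B r l [mod p ]
  row-⊗ B l = subst (λ x → x ≡ B r l [mod p ]) rowSplit
                    (∣⇒+≡[mod] (sumℤ defect) (B r l) (sumℤ-∣ defect p∣defect))
    where
    defect : Fin m → ℤ
    defect t = (A r t - δ r t) * B t l
    p∣defect : ∀ t → + p ℤ.∣ defect t
    p∣defect t = ℤ.∣m⇒∣m*n {m = A r t - δ r t} (B t l) (ℤ.∣ᵤ⇒∣ (rowA t))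
    recombine : ∀ a d b → (a - d) * b + d * b ≡ a * b
    recombine = solve-∀
    rowSplit : sumℤ defect + B r l ≡ (A ⊗ B) r l
    rowSplit = begin
      sumℤ defect + B r l
        ≡⟨ cong (λ s → sumℤ defect + s) (sumℤ-δ r (λ t → B t l)) ⟨
      sumℤ defect + sumℤ (λ t → δ r t * B t l)
        ≡⟨ sumℤ-+ defect (λ t → δ r t * B t l) ⟨
      sumℤ (λ t → defect t + δ r t * B t l)
        ≡⟨ sumℤ-cong (λ t → recombine (A r t) (δ r t) (B t l)) ⟩
      (A ⊗ B) r l ∎

  row-^ : ∀ k l → (A ^ k) r l ≡ δ r l [mod p ]
  row-^ zero    l = ≡[mod]-refl (δ r l)
  row-^ (suc k) l = ≡[mod]-trans ((A ^ suc k) r l) ((A ^ k) r l) (δ r l) (row-⊗ (A ^ k) l) (row-^ k l)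

  geometricSum-diag : ∀ k → geometricSum A k r r ≡ (+ k) [mod p ]
  geometricSum-diag zero    = ≡[mod]-refl (+ 0)
  geometricSum-diag (suc k) =
    subst (λ d → geometricSum A (suc k) r r ≡ (d + + k) [mod p ]) (δ-diag r)
          (≡[mod]-+ ((A ^ k) r r) (δ r r) (geometricSum A k r r) (+ k) (row-^ k r) (geometricSum-diag k))

/1≡fromℤ : ∀ z → z / 1 ≡ fromℤ z
/1≡fromℤ z = ℚ.↥p/↧p≡p (fromℤ z)

/1-injective : ∀ {a b} → a / 1 ≡ b / 1 → a ≡ b
/1-injective {a} {b} eq = begin
  a                ≡⟨ cong ℚ.↥_ (/1≡fromℤ a) ⟨
  ℚ.↥ (a / 1)      ≡⟨ cong ℚ.↥_ eq ⟩
  ℚ.↥ (b / 1)      ≡⟨ cong ℚ.↥_ (/1≡fromℤ b) ⟩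
  b                ∎

/1-+-homo : ∀ a b → (a / 1) ℚ.+ (b / 1) ≡ (a + b) / 1
/1-+-homo a b = trans (cong₂ ℚ._+_ (/1≡fromℤ a) (/1≡fromℤ b))
                      (ℚ./-cong (cong₂ _+_ (ℤ.*-identityʳ a) (ℤ.*-identityʳ b)) refl)

/1-*-homo : ∀ a b → (a / 1) ℚ.* (b / 1) ≡ (a * b) / 1
/1-*-homo a b = cong₂ ℚ._*_ (/1≡fromℤ a) (/1≡fromℤ b)

sumℚ-cong : {f g : Fin m → ℚ} → (∀ i → f i ≡ g i) → sumℚ f ≡ sumℚ g
sumℚ-cong {zero}  f≗g = refl
sumℚ-cong {suc m} f≗g = cong₂ ℚ._+_ (f≗g Fin.zero) (sumℚ-cong (λ i → f≗g (Fin.suc i)))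

sumℚ-/1 : (f : Fin m → ℤ) → sumℚ (λ i → f i / 1) ≡ sumℤ f / 1
sumℚ-/1 {zero}  f = refl
sumℚ-/1 {suc m} f = trans (cong (λ s → (f Fin.zero / 1) ℚ.+ s) (sumℚ-/1 (λ i → f (Fin.suc i))))
                          (/1-+-homo (f Fin.zero) (sumℤ (λ i → f (Fin.suc i))))

fixedVector⇒eigenvalue1 : (A : Mat ℤ m) (v : Fin m → ℤ) (r : Fin m) → ¬ v r ≡ + 0 →
                          (∀ i → sumℤ (λ j → A i j * v j) ≡ v i) → IsEigenvalue A 1ℚ
fixedVector⇒eigenvalue1 A v r vᵣ≢0 Av≡v = (λ i → v i / 1) , (r , vᵣ≢0 ∘ /1-injective) , eigen
  where
  eigen : ∀ i → sumℚ (λ j → (A i j / 1) ℚ.* (v j / 1)) ≡ 1ℚ ℚ.* (v i / 1)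
  eigen i = begin
    sumℚ (λ j → (A i j / 1) ℚ.* (v j / 1))  ≡⟨ sumℚ-cong (λ j → /1-*-homo (A i j) (v j)) ⟩
    sumℚ (λ j → (A i j * v j) / 1)          ≡⟨ sumℚ-/1 (λ j → A i j * v j) ⟩
    sumℤ (λ j → A i j * v j) / 1            ≡⟨ cong (_/ 1) (Av≡v i) ⟩
    v i / 1                                 ≡⟨ ℚ.*-identityˡ (v i / 1) ⟨
    1ℚ ℚ.* (v i / 1)                        ∎

p∤order⇒eigenvalue1 : ∀ {p} (A : Mat ℤ m) (r : Fin m) → (∀ j → A r j ≡ δ r j [mod p ]) →
                      ∀ k → (∀ i j → (A ^ k) i j ≡ I i j) → ¬ p ∣ k → IsEigenvalue A 1ℚ
p∤order⇒eigenvalue1 A r rowA k Aᵏ≡I p∤k =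
  fixedVector⇒eigenvalue1 A (λ i → geometricSum A k i r) r vᵣ≢0
                          (λ i → ^≡I⇒⊗-geometricSum A k Aᵏ≡I i r)
  where
  vᵣ≢0 : ¬ geometricSum A k r r ≡ + 0
  vᵣ≢0 vᵣ≡0 =
    p∤k (0≡[mod]⇒∣ k (subst (λ x → x ≡ (+ k) [mod _ ]) vᵣ≡0 (geometricSum-diag A r rowA k)))

prime≥5∤12 : ∀ {p} → Prime p → 5 ≤ p → ¬ p ∣ 12
prime≥5∤12 pr 5≤p p∣12 with euclidsLemma 4 3 pr p∣12
... | inj₁ p∣4 = ℕ.<⇒≱ 5≤p (ℕ.∣⇒≤ p∣4)
... | inj₂ p∣3 = ℕ.<⇒≱ 5≤p (ℕ.≤-trans (ℕ.∣⇒≤ p∣3) (ℕ.n≤1+n 3))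

∣12 : ∀ {k} → (k ≡ 1 ⊎ k ≡ 2 ⊎ k ≡ 3 ⊎ k ≡ 4 ⊎ k ≡ 6) → k ∣ 12
∣12 (inj₁ refl)                            = ℕ.divides 12 refl
∣12 (inj₂ (inj₁ refl))                     = ℕ.divides 6 refl
∣12 (inj₂ (inj₂ (inj₁ refl)))              = ℕ.divides 4 refl
∣12 (inj₂ (inj₂ (inj₂ (inj₁ refl))))       = ℕ.divides 3 refl
∣12 (inj₂ (inj₂ (inj₂ (inj₂ refl))))       = ℕ.divides 2 refl

mainTheorem18 : (n p : ℕ) → Prime p → 5 ≤ p →
    (A : Mat ℤ (suc n)) → InΓ₁ n p A →
    (k : ℕ) → (k ≡ 1 ⊎ k ≡ 2 ⊎ k ≡ 3 ⊎ k ≡ 4 ⊎ k ≡ 6) →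
    HasOrder A k →
    IsEigenvalue A 1ℚ
mainTheorem18 n p pr 5≤p A (_ , lastRow) k k∈orders (Aᵏ≡I , _) =
  p∤order⇒eigenvalue1 A (fromℕ n) lastRow k Aᵏ≡I
                      (λ p∣k → prime≥5∤12 pr 5≤p (ℕ.∣-trans p∣k (∣12 k∈orders)))
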